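{- Let $G$ be a graph without universal vertices and let $\alpha\colon V(G)\to\mathcal{A}$ be a Helly arc representation of $G$ whose arc model $\mathcal{A}$ is sharp. Let $C$ be a maxclique of $G$ and consider the $C$-flipped mapping $\alpha^C\colon V(G)\to\mathcal{A}^{\alpha(C)}$. Then $\mathcal{I}=\mathcal{A}^{\alpha(C)}$ is an interval system, in the sense that there are two consecutive points $x,y$ of the circle such that no arc $I\in\mathcal{I}$ contains both $x$ and $y$ unless $I=[x,y]$ is the complete arc with designated extreme points $x$ and $y$.
   Context: On the directed cycle $1\to\dots\to n\to1$, an arc $[a,b]$ is the set of points on the directed path from $a$ to $b$; a non-complete arc has start point $a$ and end point $b$. The complete arc $\{1,\dots,n\}$ written as $[1,n]$ or $[a,a-1]$ is a complete arc with designated extreme points. Flipping an arc $A=[a,b]$ with $a\neq b$ gives $\tilde A=[b,a]$. For $X\subseteq\mathcal{A}$, $\mathcal{A}^X=\{\tilde A:A\in X\}\cup(\mathcal{A}\setminus X)$; for $C\subseteq V(G)$, $\alpha^C(v)=\widetilde{\alpha(v)}$ if $v\in C$ and $\alpha^C(v)=\alpha(v)$ otherwise. A Helly arc representation of $G$ is a map $\alpha$ from $V(G)$ onto an arc system $\mathcal{A}$ having the Helly property (pairwise intersecting arcs share a point) such that distinct $u,v$ are adjacent iff $\alpha(u)\cap\alpha(v)\neq\emptyset$. A system of $m$ arcs on the $2m$-point circle is sharp if all extreme points of its arcs are pairwise distinct. A universal vertex is adjacent to all other vertices; a maxclique is an inclusion-maximal clique. -}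

module Defs where

open import Data.Nat using (ℕ; zero; suc; _+_; _∸_; _≤_; _≤?_)
open import Data.Fin using (Fin; toℕ)
open import Data.Fin.Subset using (Subset; _∈_; _∉_; _⊆_)
open import Data.Bool using (Bool; true; false)
open import Data.Product using (Σ; ∃; _×_; _,_)
open import Data.Sum using (_⊎_)
open import Relation.Nullary using (¬_; yes; no)
open import Relation.Binary.PropositionalEquality using (_≡_; _≢_)

-- The directed cycle 1 → 2 → … → N → 1, with points represented by Fin N
-- (point i+1 of the paper is  i : Fin N), so the successor of point p is
-- p+1 mod N.

Next : (N : ℕ) → Fin N → Fin N → Set
Next N y x = (suc (toℕ y) ≡ toℕ x) ⊎ ((toℕ x ≡ 0) × (suc (toℕ y) ≡ N))

steps : (N : ℕ) → Fin N → Fin N → ℕ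
steps N a p with toℕ a ≤? toℕ p
... | yes _ = toℕ p ∸ toℕ a
... | no  _ = (N ∸ toℕ a) + toℕ p

-- An arc [start , end]: the points of the directed path from start to end.
-- (When end is the predecessor of start this is the complete arc with
-- designated extreme points start and end.)
record Arc (N : ℕ) : Set where
  constructor [_,_]
  field
    start : Fin N
    end   : Fin N
open Arc public

_∈ᵃ_ : {N : ℕ} → Fin N → Arc N → Set
_∈ᵃ_ {N} p A = steps N (start A) p ≤ steps N (start A) (end A)

flip : {N : ℕ} → Arc N → Arc N
flip A = [ end A , start A ]

Intersect : {N : ℕ} → Arc N → Arc N → Set
Intersect A B = ∃ λ p → p ∈ᵃ A × p ∈ᵃ B

extreme : {N : ℕ} → Arc N → Bool → Fin N
extreme A true  = start A
extreme A false = end A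

Helly : {m N : ℕ} → (Fin m → Arc N) → Set
Helly {m} {N} 𝒜 =
  (S : Subset m) → (∃ λ i → i ∈ S) →
  (∀ i j → i ∈ S → j ∈ S → Intersect (𝒜 i) (𝒜 j)) →
  ∃ λ (p : Fin N) → ∀ i → i ∈ S → p ∈ᵃ 𝒜 i

Sharp : {m : ℕ} → (Fin m → Arc (m + m)) → Set
Sharp {m} 𝒜 =
  ∀ (i j : Fin m) (s t : Bool) →
  extreme (𝒜 i) s ≡ extreme (𝒜 j) t → (i ≡ j) × (s ≡ t)

-- The flipped system 𝒜^X for X ⊆ 𝒜 (X given as a predicate on the index
-- set of 𝒜): membership of an arc in 𝒜^X.
InFlipped : {m N : ℕ} → (Fin m → Arc N) → (Fin m → Set) → Arc N → Set
InFlipped {m} 𝒜 X I =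
  ∃ λ (i : Fin m) → (X i × I ≡ flip (𝒜 i)) ⊎ (¬ X i × I ≡ 𝒜 i)

IntervalSystem : {N : ℕ} → (Arc N → Set) → Set
IntervalSystem {N} ℐ =
  ∃ λ (y : Fin N) → ∃ λ (x : Fin N) → Next N y x ×
    (∀ I → ℐ I → x ∈ᵃ I → y ∈ᵃ I → I ≡ [ x , y ])

record Graph (k : ℕ) : Set₁ where
  field
    Adj   : Fin k → Fin k → Set
    sym   : ∀ {u v} → Adj u v → Adj v u
    irrefl : ∀ {u} → ¬ Adj u u
open Graph public

Universal : {k : ℕ} → Graph k → Fin k → Set
Universal G v = ∀ w → w ≢ v → Adj G v w

IsClique : {k : ℕ} → Graph k → Subset k → Set
IsClique G C = ∀ u v → u ∈ C → v ∈ C → u ≢ v → Adj G u v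

IsMaxclique : {k : ℕ} → Graph k → Subset k → Set
IsMaxclique G C = IsClique G C × (∀ D → IsClique G D → C ⊆ D → D ⊆ C)

IsHellyArcRep : {k m N : ℕ} → Graph k → (Fin m → Arc N) → (Fin k → Fin m) → Set
IsHellyArcRep {k} {m} G 𝒜 α =
  (∀ i → ∃ λ v → α v ≡ i) × Helly 𝒜 ×
  (∀ u v → u ≢ v → (Adj G u v → Intersect (𝒜 (α u)) (𝒜 (α v)))
                 × (Intersect (𝒜 (α u)) (𝒜 (α v)) → Adj G u v))

Image : {k m : ℕ} → (Fin k → Fin m) → Subset k → Fin m → Set
Image α C i = ∃ λ v → v ∈ C × α v ≡ i

module Submission where

-- Let X = α(C).  The arcs of X pairwise intersect, so by the Helly property
-- they share a point p.  Some arc of X has its start point y on every arc of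
-- X: if the start of A ∈ X misses B ∈ X, then the start of B lies strictly
-- closer to p along the cycle than the start of A, so a descent on this
-- distance ends at such an arc.  Let x be the successor of y; we claim that
-- an arc I of 𝒜^X through x and y is [x , y].
--   * If I = [b , a] is the flip of [a , b] ∈ X, then y lies on both [a , b]
--     and [b , a], hence y ∈ {a , b}; by sharpness y ≠ b, so y = a, and the
--     successor x of a lies on [b , a] only if x = b.
--   * If I is an unflipped arc α(w), then α(w) meets every arc of C at y, so
--     w is adjacent to all of C and maximality forces w ∈ C, i.e. I ∈ X.

open import Defs hiding (sym)
open import Data.Nat using (ℕ; zero; suc; _+_; _∸_; _≥_; _<_; _≤_; _≤?_; z≤n; s≤s)
open import Data.Nat.Properties
  using (≤-refl; ≤-trans; ≤-antisym; <⇒≤; <⇒≱; ≰⇒>; <-asym; ≤-<-trans; <-≤-trans;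
         ≤-pred; m≤m+n; m∸n≤m; n∸n≡0; m∸n+n≡m; m<n⇒0<n∸m; +-monoˡ-≤; +-monoʳ-≤;
         +-monoˡ-<; +-cancelˡ-≤; ∸-monoˡ-≤; ∸-monoˡ-<; ∸-monoʳ-<)
open import Data.Fin using (Fin; zero; suc; toℕ; _≟_)
open import Data.Fin.Properties using (toℕ<n; toℕ-injective; any?; all?; ¬∀⟶∃¬)
open import Data.Fin.Subset using (Subset; _∈_; _∪_; ⁅_⁆)
open import Data.Fin.Subset.Properties
  using (_∈?_; nonempty?; x∈⁅x⁆; x∈⁅y⁆⇒x≡y; x∈p∪q⁻; x∈p∪q⁺; p⊆p∪q)
open import Data.Vec using (tabulate)
open import Data.Vec.Properties using (lookup∘tabulate; []=⇒lookup; lookup⇒[]=)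
open import Data.Bool using (true; false)
open import Data.Product using (∃; _×_; _,_; proj₁; proj₂; map₂)
open import Data.Sum using (_⊎_; inj₁; inj₂)
open import Data.Empty using (⊥-elim)
open import Relation.Nullary using (¬_; Dec; yes; no; does)
open import Relation.Nullary.Decidable using (_×-dec_; _→-dec_; dec-true)
open import Relation.Binary.PropositionalEquality
  using (_≡_; _≢_; refl; sym; trans; subst; subst₂; cong)

steps-≤ : ∀ {N} (a p : Fin N) → toℕ a ≤ toℕ p → steps N a p ≡ toℕ p ∸ toℕ a
steps-≤ {N} a p a≤p with toℕ a ≤? toℕ p
... | yes _   = refl
... | no a≰p = ⊥-elim (a≰p a≤p)

steps-> : ∀ {N} (a p : Fin N) → toℕ p < toℕ a → steps N a p ≡ (N ∸ toℕ a) + toℕ p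
steps-> {N} a p p<a with toℕ a ≤? toℕ p
... | yes a≤p = ⊥-elim (<⇒≱ p<a a≤p)
... | no _    = refl

Within : ℕ → ℕ → ℕ → Set
Within A B P = (A ≤ B × A ≤ P × P ≤ B) ⊎ (B < A × (A ≤ P ⊎ P ≤ B))

∈ᵃ⇒Within : ∀ {N} (a b p : Fin N) → p ∈ᵃ [ a , b ] → Within (toℕ a) (toℕ b) (toℕ p)
∈ᵃ⇒Within {N} a b p p∈ = cases (toℕ a ≤? toℕ b) (toℕ a ≤? toℕ p)
  where
    cases : Dec (toℕ a ≤ toℕ b) → Dec (toℕ a ≤ toℕ p) → Within (toℕ a) (toℕ b) (toℕ p)
    cases (yes a≤b) (yes a≤p) = inj₁ (a≤b , a≤p , p≤b)
      where
        p∸a≤b∸a : toℕ p ∸ toℕ a ≤ toℕ b ∸ toℕ a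
        p∸a≤b∸a = subst₂ _≤_ (steps-≤ a p a≤p) (steps-≤ a b a≤b) p∈
        p≤b : toℕ p ≤ toℕ b
        p≤b = subst₂ _≤_ (m∸n+n≡m a≤p) (m∸n+n≡m a≤b) (+-monoˡ-≤ (toℕ a) p∸a≤b∸a)
    cases (yes a≤b) (no a≰p) =
      ⊥-elim (<⇒≱ (∸-monoˡ-< (toℕ<n b) a≤b) (≤-trans (m≤m+n _ _) wrapped))
      where
        wrapped : (N ∸ toℕ a) + toℕ p ≤ toℕ b ∸ toℕ a
        wrapped = subst₂ _≤_ (steps-> a p (≰⇒> a≰p)) (steps-≤ a b a≤b) p∈
    cases (no a≰b) (yes a≤p) = inj₂ (≰⇒> a≰b , inj₁ a≤p)
    cases (no a≰b) (no a≰p) = inj₂ (≰⇒> a≰b , inj₂ (+-cancelˡ-≤ (N ∸ toℕ a) _ _ wrapped))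
      where
        wrapped : (N ∸ toℕ a) + toℕ p ≤ (N ∸ toℕ a) + toℕ b
        wrapped = subst₂ _≤_ (steps-> a p (≰⇒> a≰p)) (steps-> a b (≰⇒> a≰b)) p∈

Within⇒∈ᵃ : ∀ {N} (a b p : Fin N) → Within (toℕ a) (toℕ b) (toℕ p) → p ∈ᵃ [ a , b ]
Within⇒∈ᵃ {N} a b p (inj₁ (a≤b , a≤p , p≤b)) =
  subst₂ _≤_ (sym (steps-≤ a p a≤p)) (sym (steps-≤ a b a≤b)) (∸-monoˡ-≤ (toℕ a) p≤b)
Within⇒∈ᵃ {N} a b p (inj₂ (b<a , inj₁ a≤p)) =
  subst₂ _≤_ (sym (steps-≤ a p a≤p)) (sym (steps-> a b b<a))
    (≤-trans (∸-monoˡ-≤ (toℕ a) (<⇒≤ (toℕ<n p))) (m≤m+n _ _))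
Within⇒∈ᵃ {N} a b p (inj₂ (b<a , inj₂ p≤b)) =
  subst₂ _≤_ (sym (steps-> a p (≤-<-trans p≤b b<a))) (sym (steps-> a b b<a))
    (+-monoʳ-≤ (N ∸ toℕ a) p≤b)

start∈ᵃ : ∀ {N} (A : Arc N) → start A ∈ᵃ A
start∈ᵃ {N} A = subst (_≤ steps N (start A) (end A)) (sym zero-steps) z≤n
  where
    zero-steps : steps N (start A) (start A) ≡ 0
    zero-steps = trans (steps-≤ (start A) (start A) ≤-refl) (n∸n≡0 (toℕ (start A)))

_∈ᵃ?_ : ∀ {N} (p : Fin N) (A : Arc N) → Dec (p ∈ᵃ A)
_∈ᵃ?_ {N} p A = steps N (start A) p ≤? steps N (start A) (end A)

successor : ∀ {N} (y : Fin N) → ∃ λ x → Next N y x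
successor {suc zero}    zero    = zero , inj₂ (refl , refl)
successor {suc (suc n)} zero    = suc zero , inj₁ refl
successor {suc n}       (suc y) with successor y
... | x , inj₁ y→x       = suc x , inj₁ (cong suc y→x)
... | _ , inj₂ (_ , y→0) = zero , inj₂ (refl , cong suc y→0)

arc∩flip⊆extremes : ∀ {N} {a b y : Fin N} → a ≢ b →
  y ∈ᵃ [ a , b ] → y ∈ᵃ [ b , a ] → (y ≡ a) ⊎ (y ≡ b)
arc∩flip⊆extremes {a = a} {b} {y} a≢b y∈ab y∈ba =
  meet (∈ᵃ⇒Within a b y y∈ab) (∈ᵃ⇒Within b a y y∈ba)
  where
    meet : Within (toℕ a) (toℕ b) (toℕ y) → Within (toℕ b) (toℕ a) (toℕ y) → (y ≡ a) ⊎ (y ≡ b)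
    meet (inj₁ (a≤b , _ , _))     (inj₁ (b≤a , _ , _))   = ⊥-elim (a≢b (toℕ-injective (≤-antisym a≤b b≤a)))
    meet (inj₁ (_ , _ , y≤b))     (inj₂ (_ , inj₁ b≤y))  = inj₂ (toℕ-injective (≤-antisym y≤b b≤y))
    meet (inj₁ (_ , a≤y , _))     (inj₂ (_ , inj₂ y≤a))  = inj₁ (toℕ-injective (≤-antisym y≤a a≤y))
    meet (inj₂ (_ , inj₁ a≤y))    (inj₁ (_ , _ , y≤a))   = inj₁ (toℕ-injective (≤-antisym y≤a a≤y))
    meet (inj₂ (_ , inj₂ y≤b))    (inj₁ (_ , b≤y , _))   = inj₂ (toℕ-injective (≤-antisym y≤b b≤y))
    meet (inj₂ (b<a , _))         (inj₂ (a<b , _))       = ⊥-elim (<-asym a<b b<a)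

successor-of-end : ∀ {N} {a b x : Fin N} → Next N a x → x ∈ᵃ [ b , a ] → x ≡ b
successor-of-end {N} {a} {b} {x} a→x x∈ba = cases a→x (∈ᵃ⇒Within b a x x∈ba)
  where
    cases : Next N a x → Within (toℕ b) (toℕ a) (toℕ x) → x ≡ b
    cases (inj₁ a→x)       (inj₁ (_ , _ , x≤a))     = ⊥-elim (<⇒≱ (subst (toℕ a <_) a→x ≤-refl) x≤a)
    cases (inj₂ (x≡0 , _)) (inj₁ (_ , b≤x , _))     =
      toℕ-injective (≤-antisym (subst (_≤ toℕ b) (sym x≡0) z≤n) b≤x)
    cases (inj₁ a→x)       (inj₂ (a<b , inj₁ b≤x)) = toℕ-injective (≤-antisym (subst (_≤ toℕ b) a→x a<b) b≤x)
    cases (inj₁ a→x)       (inj₂ (_ , inj₂ x≤a))   = ⊥-elim (<⇒≱ (subst (toℕ a <_) a→x ≤-refl) x≤a)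
    cases (inj₂ (_ , a→N)) (inj₂ (a<b , _))         = ⊥-elim (<⇒≱ (subst (toℕ b <_) (sym a→N) (toℕ<n b)) a<b)

Within-initial : ∀ {A B P Y} → Within A B P → A ≤ Y → Y ≤ P → Within A B Y
Within-initial (inj₁ (a≤b , _ , p≤b)) a≤y y≤p = inj₁ (a≤b , a≤y , ≤-trans y≤p p≤b)
Within-initial (inj₂ (b<a , _))        a≤y _   = inj₂ (b<a , inj₁ a≤y)

Within-wrapped : ∀ {A B P} → Within A B P → P < A → B < A × P ≤ B
Within-wrapped (inj₁ (_ , a≤p , _))    p<a = ⊥-elim (<⇒≱ p<a a≤p)
Within-wrapped (inj₂ (b<a , inj₁ a≤p)) p<a = ⊥-elim (<⇒≱ p<a a≤p)
Within-wrapped (inj₂ (b<a , inj₂ p≤b)) _   = b<a , p≤b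

-- If p lies on [a , b] and y does not, then a is strictly closer to p than
-- y is, walking along the cycle: the walk from y to p passes through a.
start-is-closer : ∀ {N} (a b p y : Fin N) → p ∈ᵃ [ a , b ] → ¬ (y ∈ᵃ [ a , b ]) →
  steps N a p < steps N y p
start-is-closer {N} a b p y p∈ y∉ = closer (toℕ a ≤? toℕ p) (toℕ y ≤? toℕ p)
  where
    p-on : Within (toℕ a) (toℕ b) (toℕ p)
    p-on = ∈ᵃ⇒Within a b p p∈
    wraps : toℕ p < toℕ a → toℕ b < toℕ a × toℕ p ≤ toℕ b
    wraps = Within-wrapped p-on
    closer : Dec (toℕ a ≤ toℕ p) → Dec (toℕ y ≤ toℕ p) → steps N a p < steps N y p
    closer (yes a≤p) (yes y≤p) =
      subst₂ _<_ (sym (steps-≤ a p a≤p)) (sym (steps-≤ y p y≤p)) (∸-monoʳ-< y<a a≤p)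
      where
        y<a : toℕ y < toℕ a
        y<a = ≰⇒> λ a≤y → y∉ (Within⇒∈ᵃ a b y (Within-initial p-on a≤y y≤p))
    closer (yes a≤p) (no y≰p) =
      subst₂ _<_ (sym (steps-≤ a p a≤p)) (sym (steps-> y p (≰⇒> y≰p)))
        (≤-trans (s≤s (m∸n≤m (toℕ p) (toℕ a))) (+-monoˡ-≤ (toℕ p) (m<n⇒0<n∸m (toℕ<n y))))
    closer (no a≰p) (yes y≤p) with wraps (≰⇒> a≰p)
    ... | b<a , p≤b = ⊥-elim (y∉ (Within⇒∈ᵃ a b y (inj₂ (b<a , inj₂ (≤-trans y≤p p≤b)))))
    closer (no a≰p) (no y≰p) =
      subst₂ _<_ (sym (steps-> a p (≰⇒> a≰p))) (sym (steps-> y p (≰⇒> y≰p)))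
        (+-monoˡ-< (toℕ p) (∸-monoʳ-< y<a (<⇒≤ (toℕ<n a))))
      where
        y<a : toℕ y < toℕ a
        y<a = ≰⇒> λ a≤y → y∉ (Within⇒∈ᵃ a b y (inj₂ (proj₁ (wraps (≰⇒> a≰p)) , inj₁ a≤y)))

flip-through-consecutive : ∀ {N} {a b y x : Fin N} → a ≢ b → y ≢ b → Next N y x →
  y ∈ᵃ [ a , b ] → y ∈ᵃ [ b , a ] → x ∈ᵃ [ b , a ] → [ b , a ] ≡ [ x , y ]
flip-through-consecutive a≢b y≢b y→x y∈ab y∈ba x∈ba with arc∩flip⊆extremes a≢b y∈ab y∈ba
... | inj₂ y≡b  = ⊥-elim (y≢b y≡b)
... | inj₁ refl = cong [_, _ ] (sym (successor-of-end y→x x∈ba))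

sharp-start≢end : ∀ {m} (𝒜 : Fin m → Arc (m + m)) → Sharp 𝒜 → ∀ i j → start (𝒜 i) ≢ end (𝒜 j)
sharp-start≢end _ sharp i j s≡e with sharp i j true false s≡e
... | _ , ()

maxclique-absorbs : ∀ {k} (G : Graph k) (C : Subset k) → IsMaxclique G C →
  ∀ w → (∀ u → u ∈ C → u ≢ w → Adj G u w) → w ∈ C
maxclique-absorbs G C (clique , maximal) w adj =
  maximal (C ∪ ⁅ w ⁆) extended (p⊆p∪q ⁅ w ⁆) (x∈p∪q⁺ (inj₂ (x∈⁅x⁆ w)))
  where
    extended : IsClique G (C ∪ ⁅ w ⁆)
    extended u v u∈D v∈D u≢v with x∈p∪q⁻ C ⁅ w ⁆ u∈D | x∈p∪q⁻ C ⁅ w ⁆ v∈D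
    ... | inj₁ u∈C | inj₁ v∈C = clique u v u∈C v∈C u≢v
    ... | inj₁ u∈C | inj₂ v∈w with refl ← x∈⁅y⁆⇒x≡y w v∈w = adj u u∈C u≢v
    ... | inj₂ u∈w | inj₁ v∈C with refl ← x∈⁅y⁆⇒x≡y w u∈w =
      Graph.sym G (adj v v∈C (λ v≡u → u≢v (sym v≡u)))
    ... | inj₂ u∈w | inj₂ v∈w = ⊥-elim (u≢v (trans (x∈⁅y⁆⇒x≡y w u∈w) (sym (x∈⁅y⁆⇒x≡y w v∈w))))

-- A maxclique of a graph with at least one vertex is nonempty: were it
-- empty, vertex 0 would vacuously be adjacent to all of it.
maxclique-nonempty : ∀ {k} (G : Graph (suc k)) (C : Subset (suc k)) → IsMaxclique G C →
  ∃ λ u → u ∈ C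
maxclique-nonempty G C maxC with nonempty? C
... | yes nonempty = nonempty
... | no empty     = zero , maxclique-absorbs G C maxC zero (λ u u∈C _ → ⊥-elim (empty (u , u∈C)))

does-true : ∀ {A : Set} (a? : Dec A) → does a? ≡ true → A
does-true (yes a) _  = a
does-true (no _)  ()

helly-for : ∀ {m N} (𝒜 : Fin m → Arc N) → Helly 𝒜 → {X : Fin m → Set} → (∀ i → Dec (X i)) →
  ∃ X → (∀ i j → X i → X j → Intersect (𝒜 i) (𝒜 j)) → ∃ λ p → ∀ i → X i → p ∈ᵃ 𝒜 i
helly-for _ helly {X} X? (i , Xi) pairwise =
  map₂ (λ p∈S j Xj → p∈S j (to-S Xj))
       (helly S (i , to-S Xi) (λ j l j∈S l∈S → pairwise j l (from-S j∈S) (from-S l∈S)))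
  where
    S : Subset _
    S = tabulate (λ j → does (X? j))
    to-S : ∀ {j} → X j → j ∈ S
    to-S {j} Xj = lookup⇒[]= j S (trans (lookup∘tabulate _ j) (dec-true (X? j) Xj))
    from-S : ∀ {j} → j ∈ S → X j
    from-S {j} j∈S =
      does-true (X? j) (trans (sym (lookup∘tabulate _ j)) ([]=⇒lookup j∈S))

image? : ∀ {k m} (α : Fin k → Fin m) (C : Subset k) → ∀ i → Dec (Image α C i)
image? α C i = any? λ v → (v ∈? C) ×-dec (α v ≟ i)

clique-arcs-intersect : ∀ {k m N} (G : Graph k) (𝒜 : Fin m → Arc N) (α : Fin k → Fin m) →
  IsHellyArcRep G 𝒜 α → ∀ {C} → IsClique G C →
  ∀ i j → Image α C i → Image α C j → Intersect (𝒜 i) (𝒜 j)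
clique-arcs-intersect _ 𝒜 α (_ , _ , adj⇔) clique _ _ (u , u∈C , refl) (v , v∈C , refl)
  with u ≟ v
... | yes refl = start (𝒜 (α u)) , start∈ᵃ (𝒜 (α u)) , start∈ᵃ (𝒜 (α u))
... | no u≢v   = proj₁ (adj⇔ u v u≢v) (clique u v u∈C v∈C u≢v)

arc-through-common-point : ∀ {k m N} (G : Graph k) (𝒜 : Fin m → Arc N) (α : Fin k → Fin m) →
  IsHellyArcRep G 𝒜 α → ∀ {C} → IsMaxclique G C → ∀ {y} → (∀ j → Image α C j → y ∈ᵃ 𝒜 j) →
  ∀ i → y ∈ᵃ 𝒜 i → Image α C i
arc-through-common-point G _ α (onto , _ , adj⇔) {C} maxC {y} y∈C i y∈i with onto i
... | w , refl = w , maxclique-absorbs G C maxC w adjacent , refl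
  where
    adjacent : ∀ u → u ∈ C → u ≢ w → Adj G u w
    adjacent u u∈C u≢w = proj₂ (adj⇔ u w u≢w) (y , y∈C (α u) (u , u∈C , refl) , y∈i)

StartsInAll : ∀ {m N} → (Fin m → Arc N) → (Fin m → Set) → Fin m → Set
StartsInAll 𝒜 X i = ∀ j → X j → start (𝒜 i) ∈ᵃ 𝒜 j

counterexample : ∀ {P Q : Set} → Dec P → ¬ (P → Q) → P × ¬ Q
counterexample (yes p) ¬[p→q] = p , λ q → ¬[p→q] (λ _ → q)
counterexample (no ¬p) ¬[p→q] = ⊥-elim (¬[p→q] (λ p → ⊥-elim (¬p p)))

-- Descent: if the start of i ∈ X misses j ∈ X,
-- the start of j is strictly closer to p (start-is-closer).
innermost-start : ∀ {m N} (𝒜 : Fin m → Arc N) {X : Fin m → Set} → (∀ i → Dec (X i)) →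
  (p : Fin N) → (∀ i → X i → p ∈ᵃ 𝒜 i) → ∃ X → ∃ (StartsInAll 𝒜 X)
innermost-start {N = N} 𝒜 {X} X? p p∈X (i , Xi) =
  descend (suc (steps N (start (𝒜 i)) p)) i Xi ≤-refl
  where
    starts? : ∀ i j → Dec (X j → start (𝒜 i) ∈ᵃ 𝒜 j)
    starts? i j = X? j →-dec (start (𝒜 i) ∈ᵃ? 𝒜 j)
    descend : ∀ n i → X i → steps N (start (𝒜 i)) p < n → ∃ (StartsInAll 𝒜 X)
    descend zero    _ _  ()
    descend (suc n) i Xi d<n with all? (starts? i)
    ... | yes starts = i , starts
    ... | no ¬starts with ¬∀⟶∃¬ _ _ (starts? i) ¬starts
    ... | j , ¬j with counterexample (X? j) ¬j
    ... | Xj , i∉j =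
      descend n j Xj (<-≤-trans (start-is-closer (start (𝒜 j)) (end (𝒜 j)) p (start (𝒜 i)) (p∈X j Xj) i∉j) (≤-pred d<n))

interval-at-common-start : ∀ {k m} (G : Graph k) (𝒜 : Fin m → Arc (m + m)) (α : Fin k → Fin m) →
  IsHellyArcRep G 𝒜 α → Sharp 𝒜 → ∀ {C} → IsMaxclique G C →
  ∀ i₀ → StartsInAll 𝒜 (Image α C) i₀ → IntervalSystem (InFlipped 𝒜 (Image α C))
interval-at-common-start G 𝒜 α rep sharp {C} maxC i₀ y∈X with successor (start (𝒜 i₀))
... | x , y→x = start (𝒜 i₀) , x , y→x , through
  where
    through : ∀ I → InFlipped 𝒜 (Image α C) I → x ∈ᵃ I → start (𝒜 i₀) ∈ᵃ I → I ≡ [ x , start (𝒜 i₀) ]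
    through _ (i , inj₁ (i∈X , refl)) x∈I y∈I =
      flip-through-consecutive (sharp-start≢end 𝒜 sharp i i) (sharp-start≢end 𝒜 sharp i₀ i) y→x
        (y∈X i i∈X) y∈I x∈I
    through _ (i , inj₂ (i∉X , refl)) _ y∈I =
      ⊥-elim (i∉X (arc-through-common-point G 𝒜 α rep maxC y∈X i y∈I))

lemma17 : (k m : ℕ) → k ≥ 1 → (G : Graph k) →
    (∀ v → ¬ Universal G v) →
    (𝒜 : Fin m → Arc (m + m)) → (α : Fin k → Fin m) →
    IsHellyArcRep G 𝒜 α → Sharp 𝒜 →
    (C : Subset k) → IsMaxclique G C →
    IntervalSystem (InFlipped 𝒜 (Image α C))
lemma17 (suc k) m _ G _ 𝒜 α rep sharp C maxC
  with maxclique-nonempty G C maxC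
... | u , u∈C
  with helly-for 𝒜 (proj₁ (proj₂ rep)) (image? α C) (α u , u , u∈C , refl)
                 (clique-arcs-intersect G 𝒜 α rep (proj₁ maxC))
... | p , p∈X
  with innermost-start 𝒜 (image? α C) p p∈X (α u , u , u∈C , refl)
... | i₀ , starts = interval-at-common-start G 𝒜 α rep sharp maxC i₀ starts
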